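{- If a finite simple graph $G$ has an acyclic vertex $k$-coloring, then $\operatorname{tlir}(G) \leq k$.
   Context: An acyclic vertex $k$-coloring is a proper vertex coloring with $k$ colors in which every two color classes together induce a forest. A total coloring of $G$ assigns a color to every vertex and every edge. For a color $c$ and a vertex $v$, the total $c$-degree of $v$ is the number of edges of color $c$ incident to $v$, plus $1$ if $v$ has color $c$. A total coloring is a locally irregular total coloring (TLIR coloring) if for every edge $uv$, with $c$ the color of $uv$, the total $c$-degrees of $u$ and $v$ differ. $\operatorname{tlir}(G)$ is the minimum number of colors in a TLIR coloring of $G$. -}

module Defs where

open import Data.Nat using (ℕ; zero; suc; _+_)
open import Data.Bool using (Bool; true; false; if_then_else_; _∧_)
open import Data.Fin using (Fin; zero; suc)
open import Data.Fin.Properties using () renaming (_≟_ to _≟ᶠ_)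
open import Data.List using (List; map; allFin)
open import Data.Nat.ListAction using (sum)
open import Data.Vec using (Vec; lookup)
open import Data.Product using (Σ; _×_; _,_)
open import Data.Sum using (_⊎_)
open import Data.Empty using (⊥)
open import Relation.Nullary using (¬_; does)
open import Relation.Binary.PropositionalEquality using (_≡_; _≢_)

record Graph (n : ℕ) : Set where
  field
    adj   : Fin n → Fin n → Bool
    sym   : ∀ u v → adj u v ≡ adj v u
    irrefl : ∀ v → adj v v ≡ false

open Graph public

Adj : ∀ {n} → Graph n → Fin n → Fin n → Set
Adj G u v = adj G u v ≡ true

-- successor index modulo m (wrap-around), used to close a cycle
next : ∀ {m} → Fin (suc m) → Fin (suc m)
next {zero} i = zero
next {suc m} zero = suc zero
next {suc m} (suc i) with next {m} i
... | zero = zero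
... | suc j = suc (suc j)

record Cycle {n} (G : Graph n) : Set where
  field
    len    : ℕ
    verts  : Vec (Fin n) (3 + len)
    distinct : ∀ i j → lookup verts i ≡ lookup verts j → i ≡ j
    closed : ∀ i → Adj G (lookup verts i) (lookup verts (next i))

ProperVertexColoring : ∀ {n} (G : Graph n) (k : ℕ) → (Fin n → Fin k) → Set
ProperVertexColoring G k f = ∀ u v → Adj G u v → f u ≢ f v

-- Acyclic vertex k-coloring: proper, and for every two colors a, b the
-- subgraph induced by the vertices of color a or b is a forest, i.e. G has
-- no cycle all of whose vertices have color a or b.
AcyclicVertexColoring : ∀ {n} (G : Graph n) (k : ℕ) → (Fin n → Fin k) → Set
AcyclicVertexColoring {n} G k f =
  ProperVertexColoring G k f ×
  (∀ (a b : Fin k) (C : Cycle G) →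
     ¬ (∀ i → (f (lookup (Cycle.verts C) i) ≡ a) ⊎ (f (lookup (Cycle.verts C) i) ≡ b)))

HasAcyclicVertexColoring : ∀ {n} (G : Graph n) (k : ℕ) → Set
HasAcyclicVertexColoring {n} G k = Σ (Fin n → Fin k) (AcyclicVertexColoring G k)

-- The edge coloring is given as a function on ordered pairs that must be
-- symmetric on edges; its values on non-edges are irrelevant.
record TotalColoring {n} (G : Graph n) (k : ℕ) : Set where
  field
    vcol : Fin n → Fin k
    ecol : Fin n → Fin n → Fin k
    ecol-sym : ∀ u v → Adj G u v → ecol u v ≡ ecol v u

open TotalColoring public

indicator : Bool → ℕ
indicator true = 1
indicator false = 0

totalDeg : ∀ {n} {G : Graph n} {k} → TotalColoring G k → Fin k → Fin n → ℕ
totalDeg {n} {G} τ c v =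
  sum (map (λ w → indicator (adj G v w ∧ does (ecol τ v w ≟ᶠ c))) (allFin n))
  + indicator (does (vcol τ v ≟ᶠ c))

IsTLIR : ∀ {n} {G : Graph n} {k} → TotalColoring G k → Set
IsTLIR {n} {G} τ =
  ∀ u v → Adj G u v → totalDeg τ (ecol τ u v) u ≢ totalDeg τ (ecol τ u v) v

TlirAtMost : ∀ {n} (G : Graph n) (k : ℕ) → Set
TlirAtMost G k = Σ (TotalColoring G k) IsTLIR

module Submission where

-- For colours a and b the vertices coloured a or b induce a forest, so they admit a
-- ranking in which every vertex has at most one higher-ranked neighbour among them
-- (delete a vertex of degree at most 1 and recurse; one exists because a
-- non-backtracking walk in a forest cannot go on forever). Orient each edge uv towards
-- its higher endpoint in the ranking for {f u, f v}, colour vertices by f and every edge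
-- by the colour of its head. The head h of an edge th then has total f(h)-degree at
-- least 2 (itself and th), while the tail t has total f(h)-degree at most 1: f t ≠ f h,
-- and the out-neighbours of t carry pairwise distinct colours.

open import Data.Bool as Bool using (Bool; true; false; _∧_)
open import Data.Bool.Properties using (∧-conicalˡ; ∧-conicalʳ)
open import Data.Fin using (Fin; zero; suc; toℕ; fromℕ<)
open import Data.Fin.Subset using (Subset; _∈_; _⊆_; _⊂_; _-_; ⁅_⁆; Nonempty)
open import Data.Fin.Subset.Induction using (⊂-wellFounded)
open import Data.Fin.Subset.Properties
  using (_∈?_; nonempty?; x∈p∧x≢y⇒x∈p-y; x∈p⇒p-x⊂p; p─q⊆p)
open import Data.Fin.Properties
  using (_≟_; any?; all?; pigeonhole; toℕ<n; toℕ-fromℕ<; toℕ-injective)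
  renaming (suc-injective to Fin-suc-injective; 0≢1+n to zero≢suc;
            _≤?_ to _≤ᶠ?_; ≤-antisym to ≤ᶠ-antisym; ≤-total to ≤ᶠ-total)
open import Data.List using (map; allFin)
open import Data.List.Properties using (map-tabulate)
open import Data.Nat using (ℕ; zero; suc; _+_; _≤_; _<_; z≤n; s≤s⁻¹; s<s⁻¹)
open import Data.Nat.ListAction using (sum)
open import Data.Nat.Properties
  using (_<?_; ≤-reflexive; ≤-trans; ≤-antisym; <-≤-trans; ≤-<-trans; <-asym; <-cmp; ≮⇒≥; <⇒≱; <⇒≢;
         n<1+n; m≤m+n; m≤n+m; m≤n⇒m<n∨m≡n; m≤n⇒∃[o]m+o≡n; +-suc; +-comm; +-identityʳ;
         +-monoˡ-<; +-monoˡ-≤; suc-injective)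
open import Data.Product using (Σ; ∃; ∃₂; _×_; _,_; proj₁; proj₂)
open import Data.Sum using (_⊎_; inj₁; inj₂; [_,_]; swap)
open import Data.Vec using (Vec; lookup; tabulate)
open import Data.Vec.Properties using (lookup∘tabulate; lookup⇒[]=; []=⇒lookup)
open import Function using (_∘_; id)
open import Function.Definitions using (Injective)
open import Induction.WellFounded using (module All)
open import Relation.Binary.Definitions using (tri<; tri≈; tri>)
open import Relation.Binary.PropositionalEquality
  using (_≡_; _≢_; refl; sym; trans; cong; cong₂; subst; ≢-sym)
open import Relation.Nullary
  using (¬_; ¬?; Dec; yes; no; does; contradiction; _×-dec_; _→-dec_; _⊎-dec_)
open import Relation.Nullary.Decidable using (dec-true; dec-false; map′; decidable-stable)
open import Relation.Unary using (Pred; Decidable)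
open import Defs hiding (sym)

AtMostOne : ∀ {n} → Pred (Fin n) _ → Set
AtMostOne P = ∀ {x y} → P x → P y → x ≡ y

atMostOne? : ∀ {n} {P : Pred (Fin n) _} → Decidable P → Dec (AtMostOne P)
atMostOne? P? = map′ (λ h {x} {y} → h x y) (λ h x y → h)
  (all? λ x → all? λ y → P? x →-dec P? y →-dec x ≟ y)

count : ∀ {n} → (Fin n → Bool) → ℕ
count {n} b = sum (map (λ x → indicator (b x)) (allFin n))

count-suc : ∀ {n} (b : Fin (suc n) → Bool) → count b ≡ indicator (b zero) + count (b ∘ suc)
count-suc b = cong (λ xs → indicator (b zero) + sum xs)
  (trans (map-tabulate suc ind) (sym (map-tabulate id (ind ∘ suc))))
  where ind = λ x → indicator (b x)

indicator≤count : ∀ {n} (b : Fin n → Bool) x → indicator (b x) ≤ count b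
indicator≤count b zero    rewrite count-suc b = m≤m+n _ _
indicator≤count b (suc x) rewrite count-suc b =
  ≤-trans (indicator≤count (b ∘ suc) x) (m≤n+m _ _)

count≡0 : ∀ {n} (b : Fin n → Bool) → (∀ x → b x ≢ true) → count b ≡ 0
count≡0 {zero}  b none = refl
count≡0 {suc n} b none rewrite count-suc b with b zero in b₀
... | true  = contradiction b₀ (none zero)
... | false = count≡0 (b ∘ suc) (none ∘ suc)

count≤1 : ∀ {n} (b : Fin n → Bool) → AtMostOne (λ x → b x ≡ true) → count b ≤ 1
count≤1 {zero}  b unique = z≤n
count≤1 {suc n} b unique rewrite count-suc b with b zero in b₀
... | true  = ≤-reflexive (cong suc (count≡0 (b ∘ suc) (λ x → zero≢suc ∘ unique b₀)))
... | false = count≤1 (b ∘ suc) (λ bx by → Fin-suc-injective (unique bx by))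

fromDec : ∀ {n ℓ} {P : Pred (Fin n) ℓ} → Decidable P → Subset n
fromDec P? = tabulate (does ∘ P?)

∈-fromDec⁺ : ∀ {n ℓ} {P : Pred (Fin n) ℓ} (P? : Decidable P) {x} → P x → x ∈ fromDec P?
∈-fromDec⁺ P? {x} px =
  lookup⇒[]= x _ (trans (lookup∘tabulate (does ∘ P?) x) (dec-true (P? x) px))

∈-fromDec⁻ : ∀ {n ℓ} {P : Pred (Fin n) ℓ} (P? : Decidable P) {x} → x ∈ fromDec P? → P x
∈-fromDec⁻ P? {x} x∈P with P? x | trans (sym (lookup∘tabulate (does ∘ P?) x)) ([]=⇒lookup x∈P)
... | yes px | _ = px

RepeatFreeBelow : ∀ {n} → (ℕ → Fin n) → ℕ → Set
RepeatFreeBelow w j = ∀ {p q} → p < q → q < j → w p ≢ w q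

repeatFreeBelow⇒≤ : ∀ {n} {w : ℕ → Fin n} {j} → RepeatFreeBelow w j → j ≤ n
repeatFreeBelow⇒≤ {n} {w} free = ≮⇒≥ λ n<j →
  let i , i′ , i<i′ , wi≡wi′ = pigeonhole (n<1+n n) (w ∘ toℕ)
  in free i<i′ (<-≤-trans (toℕ<n i′) n<j) wi≡wi′

repeatFreeBelow-suc : ∀ {n} {w : ℕ → Fin n} {j} → RepeatFreeBelow w j →
                      (∀ (i : Fin j) → w (toℕ i) ≢ w j) → RepeatFreeBelow w (suc j)
repeatFreeBelow-suc {w = w} free fresh {p} p<q q<1+j with m≤n⇒m<n∨m≡n (s≤s⁻¹ q<1+j)
... | inj₁ q<j  = free p<q q<j
... | inj₂ refl = subst (λ i → w i ≢ w _) (toℕ-fromℕ< p<q) (fresh (fromℕ< p<q))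

-- By pigeonhole, n + 1 search steps suffice.
firstRepeat : ∀ {n} (w : ℕ → Fin n) →
              ∃₂ λ i j → i < j × w i ≡ w j × RepeatFreeBelow w j
firstRepeat {n} w = search (suc n) 0 (m≤m+n (suc n) 0) (λ _ ())
  where
  search : ∀ d j → n < d + j → RepeatFreeBelow w j →
           ∃₂ λ i j → i < j × w i ≡ w j × RepeatFreeBelow w j
  search d j n<d+j free with any? (λ (i : Fin j) → w (toℕ i) ≟ w j)
  ... | yes (i , wi≡wj) = toℕ i , j , toℕ<n i , wi≡wj , free
  search zero    j n<j   free | no fresh = contradiction (repeatFreeBelow⇒≤ free) (<⇒≱ n<j)
  search (suc d) j n<d+j free | no fresh =
    search d (suc j) (subst (n <_) (sym (+-suc d j)) n<d+j)
      (repeatFreeBelow-suc free (λ i wi≡wj → fresh (i , wi≡wj)))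

toℕ-next : ∀ {m} (i : Fin (suc m)) →
           toℕ (next i) ≡ suc (toℕ i) ⊎ (toℕ i ≡ m × next i ≡ zero)
toℕ-next {zero}  zero    = inj₂ (refl , refl)
toℕ-next {suc m} zero    = inj₁ refl
toℕ-next {suc m} (suc i) with next i | toℕ-next i
... | zero  | inj₁ ()
... | zero  | inj₂ (i≡m , _) = inj₂ (cong suc i≡m , refl)
... | suc j | inj₁ eq = inj₁ (cong suc eq)
... | suc j | inj₂ (_ , ())

module _ {n} (G : Graph n) where

  adj⇒≢ : ∀ {u v} → Adj G u v → u ≢ v
  adj⇒≢ {u} uv refl with () ← trans (sym uv) (irrefl G u)

  Walk : (ℕ → Fin n) → Set
  Walk w = ∀ t → Adj G (w t) (w (suc t))

  NonBacktracking : (ℕ → Fin n) → Set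
  NonBacktracking w = ∀ t → w (suc (suc t)) ≢ w t

  closedWalk⇒cycle : ∀ m (g : ℕ → Fin n) → Walk g → g (3 + m) ≡ g 0 →
                     RepeatFreeBelow g (3 + m) →
                     Σ (Cycle G) λ C → ∀ i → lookup (Cycle.verts C) i ≡ g (toℕ i)
  closedWalk⇒cycle m g walk closes free = C , lookup∘tabulate (g ∘ toℕ)
    where
    vs : Vec (Fin n) (3 + m)
    vs = tabulate (g ∘ toℕ)

    distinct : ∀ i j → lookup vs i ≡ lookup vs j → i ≡ j
    distinct i j eq with <-cmp (toℕ i) (toℕ j)
      | trans (sym (lookup∘tabulate (g ∘ toℕ) i)) (trans eq (lookup∘tabulate (g ∘ toℕ) j))
    ... | tri< i<j _ _ | gi≡gj = contradiction gi≡gj (free i<j (toℕ<n j))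
    ... | tri≈ _ i≡j _ | _     = toℕ-injective i≡j
    ... | tri> _ _ j<i | gi≡gj = contradiction (sym gi≡gj) (free j<i (toℕ<n i))

    closed : ∀ i → Adj G (lookup vs i) (lookup vs (next i))
    closed i rewrite lookup∘tabulate (g ∘ toℕ) i | lookup∘tabulate (g ∘ toℕ) (next i)
      with toℕ-next i
    ... | inj₁ next≡suc rewrite next≡suc = walk (toℕ i)
    ... | inj₂ (i≡last , next≡0) rewrite next≡0 | i≡last =
      subst (Adj G _) closes (walk (2 + m))

    C : Cycle G
    C = record { len = m ; verts = vs ; distinct = distinct ; closed = closed }

  nonBacktracking⇒cycle : ∀ w → Walk w → NonBacktracking w →
                          Σ (Cycle G) λ C → ∀ i → ∃ λ t → lookup (Cycle.verts C) i ≡ w t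
  nonBacktracking⇒cycle w walk nonBacktracking with firstRepeat w
  ... | i , j , i<j , wi≡wj , free with m≤n⇒∃[o]m+o≡n i<j
  ... | d , 1+i+d≡j = segment d
    (subst (λ j → w i ≡ w j) (sym j≡) wi≡wj) (subst (RepeatFreeBelow w) (sym j≡) free)
    where
    j≡ : suc (d + i) ≡ j
    j≡ = trans (cong suc (+-comm d i)) 1+i+d≡j

    segment : ∀ d → w i ≡ w (suc (d + i)) → RepeatFreeBelow w (suc (d + i)) →
              Σ (Cycle G) λ C → ∀ i → ∃ λ t → lookup (Cycle.verts C) i ≡ w t
    segment zero          wi≡wi+1 _    = contradiction wi≡wi+1 (adj⇒≢ (walk i))
    segment (suc zero)    wi≡wi+2 _    = contradiction (sym wi≡wi+2) (nonBacktracking i)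
    segment (suc (suc m)) closes  free =
      let C , C≡g = closedWalk⇒cycle m (λ t → w (t + i)) (λ t → walk (t + i)) (sym closes)
                      (λ p<q q<3+m → free (+-monoˡ-< i p<q) (+-monoˡ-< i q<3+m))
      in C , λ s → toℕ s + i , C≡g s

  NeighbourIn : Subset n → Fin n → Pred (Fin n) _
  NeighbourIn T v x = x ∈ T × Adj G v x

  neighbourIn? : ∀ T v → Decidable (NeighbourIn T v)
  neighbourIn? T v x = (x ∈? T) ×-dec (adj G v x Bool.≟ true)

  Acyclic : Subset n → Set
  Acyclic T = ∀ (C : Cycle G) → ¬ (∀ i → lookup (Cycle.verts C) i ∈ T)

  Acyclic-⊆ : ∀ {S T} → S ⊆ T → Acyclic T → Acyclic S
  Acyclic-⊆ S⊆T acyclic C inS = acyclic C (S⊆T ∘ inS)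

  anotherNeighbour : ∀ T v → ¬ AtMostOne (NeighbourIn T v) →
           ∀ u → ∃ λ x → NeighbourIn T v x × x ≢ u
  anotherNeighbour T v branching u with any? (λ x → neighbourIn? T v x ×-dec ¬? (x ≟ u))
  ... | yes found = found
  ... | no none   =
    contradiction (λ {x} {y} p q → trans (onlyU p) (sym (onlyU q))) branching
    where
    onlyU : ∀ {x} → NeighbourIn T v x → x ≡ u
    onlyU {x} p = decidable-stable (x ≟ u) (λ x≢u → none (x , p , x≢u))

  module NonBacktrackingWalk (T : Subset n)
    (branching : ∀ {v} → v ∈ T → ∀ u → ∃ λ x → NeighbourIn T v x × x ≢ u)
    {v₀} (v₀∈T : v₀ ∈ T) where

    record Arc : Set where
      constructor arc
      field
        {src tgt} : Fin n
        src∈T : src ∈ T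
        tgt∈T : tgt ∈ T
        edge  : Adj G src tgt
    open Arc

    step : Arc → Arc
    step a = let _ , (x∈T , tgt-x) , _ = branching (tgt∈T a) (src a) in arc (tgt∈T a) x∈T tgt-x

    arcs : ℕ → Arc
    arcs zero    = let _ , (x∈T , v₀-x) , _ = branching v₀∈T v₀ in arc v₀∈T x∈T v₀-x
    arcs (suc t) = step (arcs t)

    walk : ℕ → Fin n
    walk t = src (arcs t)

    walk∈T : ∀ t → walk t ∈ T
    walk∈T t = src∈T (arcs t)

    walk-adj : Walk walk
    walk-adj t = edge (arcs t)

    walk-nonBacktracking : NonBacktracking walk
    walk-nonBacktracking t = proj₂ (proj₂ (branching (tgt∈T (arcs t)) (src (arcs t))))

  acyclic⇒leaf : ∀ T → Acyclic T → Nonempty T →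
                 ∃ λ v → v ∈ T × AtMostOne (NeighbourIn T v)
  acyclic⇒leaf T acyclic (v₀ , v₀∈T)
    with any? (λ v → (v ∈? T) ×-dec atMostOne? (neighbourIn? T v))
  ... | yes leaf  = leaf
  ... | no noLeaf = contradiction C⊆T (acyclic C)
    where
    open NonBacktrackingWalk T (λ v∈T → anotherNeighbour T _ (λ leaf → noLeaf (_ , v∈T , leaf))) v₀∈T
    cycle = nonBacktracking⇒cycle walk walk-adj walk-nonBacktracking
    C = proj₁ cycle

    C⊆T : ∀ i → lookup (Cycle.verts C) i ∈ T
    C⊆T i = let t , Cᵢ≡wₜ = proj₂ cycle i in subst (_∈ T) (sym Cᵢ≡wₜ) (walk∈T t)

  record IsOneDegenerateOrder (T : Subset n) (rank : Fin n → ℕ) : Set where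
    field
      injective    : Injective _≡_ _≡_ rank
      upper-unique : ∀ {v} → v ∈ T → AtMostOne (λ x → NeighbourIn T v x × rank v < rank x)

  IsOneDegenerateOrder-⊆ : ∀ {S T r} → S ⊆ T →
                           IsOneDegenerateOrder T r → IsOneDegenerateOrder S r
  IsOneDegenerateOrder-⊆ S⊆T ord = record
    { injective    = injective
    ; upper-unique = λ v∈S ((x∈S , vx) , ltx) ((y∈S , vy) , lty) →
                       upper-unique (S⊆T v∈S) ((S⊆T x∈S , vx) , ltx) ((S⊆T y∈S , vy) , lty)
    }
    where open IsOneDegenerateOrder ord

  placeFirst : Fin n → (Fin n → ℕ) → Fin n → ℕ
  placeFirst v r x with x ≟ v
  ... | yes _ = 0
  ... | no  _ = suc (r x)

  placeFirst-injective : ∀ v {r} → Injective _≡_ _≡_ r → Injective _≡_ _≡_ (placeFirst v r)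
  placeFirst-injective v {r} r-inj {x} {y} eq with x ≟ v | y ≟ v
  ... | yes x≡v | yes y≡v = trans x≡v (sym y≡v)
  ... | no  _   | no  _   = r-inj (suc-injective eq)

  placeFirst-above : ∀ v r {m x} → suc m < placeFirst v r x → x ≢ v × m < r x
  placeFirst-above v r {x = x} lt with x ≟ v
  ... | no x≢v = x≢v , s<s⁻¹ lt

  placeFirst-order : ∀ {T v r} → v ∈ T → AtMostOne (NeighbourIn T v) →
                     IsOneDegenerateOrder (T - v) r → IsOneDegenerateOrder T (placeFirst v r)
  placeFirst-order {T} {v} {r} v∈T leaf ord = record
    { injective    = placeFirst-injective v injective
    ; upper-unique = unique
    }
    where
    open IsOneDegenerateOrder ord

    keep : ∀ {z} → z ∈ T → z ≢ v → z ∈ T - v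
    keep = x∈p∧x≢y⇒x∈p-y

    unique : ∀ {u} → u ∈ T →
             AtMostOne (λ x → NeighbourIn T u x × placeFirst v r u < placeFirst v r x)
    unique {u} u∈T ((x∈T , ux) , ltx) ((y∈T , uy) , lty) with u ≟ v
    ... | yes refl = leaf (x∈T , ux) (y∈T , uy)
    ... | no u≢v   =
      let x≢v , ltx′ = placeFirst-above v r ltx
          y≢v , lty′ = placeFirst-above v r lty
      in upper-unique (keep u∈T u≢v) ((keep x∈T x≢v , ux) , ltx′) ((keep y∈T y≢v , uy) , lty′)

  acyclic⇒oneDegenerateOrder : ∀ T → Acyclic T → ∃ (IsOneDegenerateOrder T)
  acyclic⇒oneDegenerateOrder = All.wfRec ⊂-wellFounded _ _ build
    where
    build : ∀ T → (∀ {S} → S ⊂ T → Acyclic S → ∃ (IsOneDegenerateOrder S)) →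
            Acyclic T → ∃ (IsOneDegenerateOrder T)
    build T rec acyclic with nonempty? T
    ... | no empty = toℕ , record
      { injective    = toℕ-injective
      ; upper-unique = λ v∈T → contradiction (_ , v∈T) empty
      }
    ... | yes nonempty =
      let v , v∈T , leaf = acyclic⇒leaf T acyclic nonempty
          r , ord = rec (x∈p⇒p-x⊂p v∈T) (Acyclic-⊆ (p─q⊆p T ⁅ v ⁆) acyclic)
      in placeFirst v r , placeFirst-order v∈T leaf ord

higher : ∀ {n} → (Fin n → ℕ) → Fin n → Fin n → Fin n
higher r u v with r u <? r v
... | yes _ = v
... | no  _ = u

higher-endpoint : ∀ {n} (r : Fin n → ℕ) {u v} → higher r u v ≡ u ⊎ higher r u v ≡ v
higher-endpoint r {u} {v} with r u <? r v
... | yes _ = inj₂ refl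
... | no  _ = inj₁ refl

higher-comm : ∀ {n} (r : Fin n → ℕ) {u v} → r u ≢ r v → higher r u v ≡ higher r v u
higher-comm r {u} {v} ru≢rv with r u <? r v | r v <? r u
... | yes ru<rv | yes rv<ru = contradiction ru<rv (<-asym rv<ru)
... | yes _     | no  _     = refl
... | no  _     | yes _     = refl
... | no  ru≮rv | no  rv≮ru = contradiction (≤-antisym (≮⇒≥ rv≮ru) (≮⇒≥ ru≮rv)) ru≢rv

higher-≡ʳ : ∀ {n} (r : Fin n → ℕ) {u v} → u ≢ v → higher r u v ≡ v → r u < r v
higher-≡ʳ r {u} {v} u≢v higher≡v with r u <? r v
... | yes ru<rv = ru<rv
... | no  _     = contradiction higher≡v u≢v

module _ {k} {A : Set} (h : Fin k → Fin k → A) where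

  symmetrise : Fin k → Fin k → A
  symmetrise a b with a ≤ᶠ? b
  ... | yes _ = h a b
  ... | no  _ = h b a

  symmetrise-comm : ∀ a b → symmetrise a b ≡ symmetrise b a
  symmetrise-comm a b with a ≤ᶠ? b | b ≤ᶠ? a
  ... | yes a≤b | yes b≤a rewrite ≤ᶠ-antisym a≤b b≤a = refl
  ... | yes _   | no  _   = refl
  ... | no  _   | yes _   = refl
  ... | no  a≰b | no  b≰a = contradiction (≤ᶠ-total a b) [ a≰b , b≰a ]

  symmetrise-elim : ∀ {ℓ} (P : Fin k → Fin k → A → Set ℓ) → (∀ a b → P a b (h a b)) →
                    (∀ {a b r} → P a b r → P b a r) → ∀ a b → P a b (symmetrise a b)
  symmetrise-elim P P-h P-swap a b with a ≤ᶠ? b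
  ... | yes _ = P-h a b
  ... | no  _ = P-swap (P-h b a)

record Orientation {n} (G : Graph n) : Set where
  field
    head          : Fin n → Fin n → Fin n
    head-endpoint : ∀ {u v} → Adj G u v → head u v ≡ u ⊎ head u v ≡ v
    head-sym      : ∀ {u v} → Adj G u v → head u v ≡ head v u

  Out : Fin n → Fin n → Set
  Out t x = Adj G t x × head t x ≡ x

RainbowOut : ∀ {n} {G : Graph n} {k} → Orientation G → (Fin n → Fin k) → Set
RainbowOut O f = ∀ {t x y} → Out t x → Out t y → f x ≡ f y → x ≡ y
  where open Orientation O

module _ {n} {G : Graph n} {k} (O : Orientation G) (f : Fin n → Fin k) where
  open Orientation O

  headColouring : TotalColoring G k
  headColouring = record
    { vcol = f ; ecol = λ u v → f (head u v) ; ecol-sym = λ _ _ → cong f ∘ head-sym }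

  edgesOfColour : Fin n → Fin k → Fin n → Bool
  edgesOfColour v c w = adj G v w ∧ does (f (head v w) ≟ c)

  headColouring-totalDeg-head : ∀ {t h} → Adj G t h → head t h ≡ h →
                                2 ≤ totalDeg headColouring (f h) h
  headColouring-totalDeg-head {t} {h} th head≡h rewrite dec-true (f h ≟ f h) refl =
    +-monoˡ-≤ 1 (subst (λ b → indicator b ≤ count (edgesOfColour h (f h))) edgeCounted
                      (indicator≤count (edgesOfColour h (f h)) t))
    where
    edgeCounted : edgesOfColour h (f h) t ≡ true
    edgeCounted = cong₂ _∧_ (trans (Graph.sym G h t) th)
                            (dec-true (f (head h t) ≟ f h) (cong f (trans (sym (head-sym th)) head≡h)))

  headColouring-totalDeg-foreign : RainbowOut O f → ∀ {t c} → f t ≢ c →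
                                   totalDeg headColouring c t ≤ 1
  headColouring-totalDeg-foreign rainbow {t} {c} ft≢c rewrite dec-false (f t ≟ c) ft≢c =
    ≤-trans (≤-reflexive (+-identityʳ _)) (count≤1 (edgesOfColour t c) λ bx by →
      let tx , fx≡c = outOfColour bx
          ty , fy≡c = outOfColour by
      in  rainbow tx ty (trans fx≡c (sym fy≡c)))
    where
    colour : ∀ {x} → edgesOfColour t c x ≡ true → f (head t x) ≡ c
    colour {x} e with f (head t x) ≟ c | ∧-conicalʳ (adj G t x) _ e
    ... | yes headColour | _ = headColour

    outOfColour : ∀ {x} → edgesOfColour t c x ≡ true → Out t x × f x ≡ c
    outOfColour e with head-endpoint (∧-conicalˡ _ _ e) | colour e
    ... | inj₁ head≡t | headColour = contradiction (trans (cong f (sym head≡t)) headColour) ft≢c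
    ... | inj₂ head≡x | headColour =
      (∧-conicalˡ _ _ e , head≡x) , trans (cong f (sym head≡x)) headColour

  headColouring-irregular : ProperVertexColoring G k f → RainbowOut O f →
                            ∀ {t h} → Adj G t h → head t h ≡ h →
                            totalDeg headColouring (f h) t ≢ totalDeg headColouring (f h) h
  headColouring-irregular proper rainbow th head≡h =
    <⇒≢ (≤-<-trans (headColouring-totalDeg-foreign rainbow (proper _ _ th))
                   (headColouring-totalDeg-head th head≡h))

  headColouring-tlir : ProperVertexColoring G k f → RainbowOut O f → IsTLIR headColouring
  headColouring-tlir proper rainbow u v uv with head-endpoint uv
  ... | inj₂ head≡v = subst (λ c → totalDeg headColouring c u ≢ totalDeg headColouring c v)
                            (cong f (sym head≡v))
                            (headColouring-irregular proper rainbow uv head≡v)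
  ... | inj₁ head≡u = subst (λ c → totalDeg headColouring c u ≢ totalDeg headColouring c v)
                            (cong f (sym head≡u))
                            (≢-sym (headColouring-irregular proper rainbow
                                      (trans (Graph.sym G v u) uv) (trans (sym (head-sym uv)) head≡u)))

module _ {n} {G : Graph n} {k} (f : Fin n → Fin k) (acyclic : AcyclicVertexColoring G k f) where

  bicoloured? : ∀ a b → Decidable (λ x → f x ≡ a ⊎ f x ≡ b)
  bicoloured? a b x = (f x ≟ a) ⊎-dec (f x ≟ b)

  bicoloured : Fin k → Fin k → Subset n
  bicoloured a b = fromDec (bicoloured? a b)

  bicoloured-acyclic : ∀ a b → Acyclic G (bicoloured a b)
  bicoloured-acyclic a b C C⊆ = proj₂ acyclic a b C (∈-fromDec⁻ (bicoloured? a b) ∘ C⊆)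

  bicoloured-comm : ∀ {a b} → bicoloured a b ⊆ bicoloured b a
  bicoloured-comm {a} {b} = ∈-fromDec⁺ (bicoloured? b a) ∘ swap ∘ ∈-fromDec⁻ (bicoloured? a b)

  bicolouredOrder : ∀ a b → ∃ (IsOneDegenerateOrder G (bicoloured a b))
  bicolouredOrder a b = acyclic⇒oneDegenerateOrder G (bicoloured a b) (bicoloured-acyclic a b)

  -- Symmetrised so that both orientations of an edge consult the same ranking.
  pairRank : Fin k → Fin k → Fin n → ℕ
  pairRank = symmetrise (λ a b → proj₁ (bicolouredOrder a b))

  pairRank-order : ∀ a b → IsOneDegenerateOrder G (bicoloured a b) (pairRank a b)
  pairRank-order = symmetrise-elim _ (λ a b → IsOneDegenerateOrder G (bicoloured a b))
    (λ a b → proj₂ (bicolouredOrder a b)) (IsOneDegenerateOrder-⊆ G bicoloured-comm)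

  pairOrientation : Orientation G
  pairOrientation = record
    { head          = λ u v → higher (pairRank (f u) (f v)) u v
    ; head-endpoint = λ _ → higher-endpoint _
    ; head-sym      = head-sym
    }
    where
    head-sym : ∀ {u v} → Adj G u v →
               higher (pairRank (f u) (f v)) u v ≡ higher (pairRank (f v) (f u)) v u
    head-sym {u} {v} uv = trans
      (higher-comm (pairRank (f u) (f v))
        (adj⇒≢ G uv ∘ IsOneDegenerateOrder.injective (pairRank-order (f u) (f v))))
      (cong (λ r → higher r v u) (symmetrise-comm (λ a b → proj₁ (bicolouredOrder a b)) (f u) (f v)))

  pairOrientation-rainbow : RainbowOut pairOrientation f
  pairOrientation-rainbow {t} {x} {y} (tx , head≡x) (ty , head≡y) fx≡fy =
    upper-unique (member (inj₁ refl))
      ((member (inj₂ refl) , tx) , higher-≡ʳ _ (adj⇒≢ G tx) head≡x)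
      ((member (inj₂ (sym fx≡fy)) , ty) ,
        subst (λ c → pairRank (f t) c t < pairRank (f t) c y) (sym fx≡fy)
              (higher-≡ʳ _ (adj⇒≢ G ty) head≡y))
    where
    open IsOneDegenerateOrder (pairRank-order (f t) (f x))
    member : ∀ {z} → f z ≡ f t ⊎ f z ≡ f x → z ∈ bicoloured (f t) (f x)
    member = ∈-fromDec⁺ (bicoloured? (f t) (f x))

theorem5 : ∀ {n : ℕ} (G : Graph n) (k : ℕ) → HasAcyclicVertexColoring G k → TlirAtMost G k
theorem5 G k (f , acyclic) =
  headColouring (pairOrientation f acyclic) f ,
  headColouring-tlir (pairOrientation f acyclic) f (proj₁ acyclic) (pairOrientation-rainbow f acyclic)
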